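{- Let $n$ be a positive integer with Zeckendorf representation $n=f_{\mu_1(n)}+\dots+f_{\mu_q(n)}$. (a) The greatest part of every Fibonacci partition of $n$ equals either $f_{\mu_q(n)}$ or $f_{\mu_q(n)-1}$. (b) For $r\ge 1$, the Fibonacci partitions of $f_r$ are exactly $\{f_r\}$ and, for $k=1,\dots,\lfloor (r-1)/2\rfloor$, the partitions $f_{r-2k}+f_{r-2k+1}+f_{r-2k+3}+\dots+f_{r-3}+f_{r-1}$ (parts $f_{r-2k}$ and $f_{r-2j+1}$ for $j=1,\dots,k$). In particular $F(f_r;t)=\phi_{\lfloor (r-1)/2\rfloor+1}(t)$. (c) (Rigidity) Let $n=f_{a_1}+\dots+f_{a_h}$ with $1\le a_1<\dots<a_h$ be a Fibonacci partition. Then for each $m$ with $1\le m\le q$ there exists $s$ with $1\le s\le h$ such that $f_{a_1}+\dots+f_{a_s}=f_{\mu_1(n)}+\dots+f_{\mu_m(n)}$; if moreover $m<q$, then $f_{a_{s+1}}\ge f_{\mu_m(n)}$.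
   Context: Let $f_0=f_1=1$ and $f_i=f_{i-1}+f_{i-2}$ for $i\ge 2$. A Fibonacci partition of $n\in\mathbb{N}$ is a finite set $\{f_{i_1},\dots,f_{i_h}\}$ with $1\le i_1<\dots<i_h$ and $f_{i_1}+\dots+f_{i_h}=n$. By Zeckendorf's theorem each $n$ has a unique Fibonacci partition $n=f_{\mu_1(n)}+\dots+f_{\mu_q(n)}$ with $\mu_{a+1}(n)-\mu_a(n)\ge 2$. $F_h(n)$ is the number of Fibonacci partitions of $n$ with $h$ parts and $F(n;t)=\sum_{h\ge0}F_h(n)t^h$. For $\alpha\in\mathbb{N}$, $\phi_\alpha(t)=t+t^2+\dots+t^\alpha$. -}

module Defs where

open import Data.Nat using (ℕ; zero; suc; _+_; _*_; _∸_; _≤_; _<_; _≟_; _≤?_)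
open import Data.List using (List; []; _∷_; map; length; filter; _++_)
open import Data.Nat.ListAction using (sum)
open import Relation.Nullary using (yes; no)
open import Data.List.Relation.Unary.All using (All)
open import Data.List.Relation.Unary.AllPairs using (AllPairs)
open import Data.List.Relation.Unary.Linked using (Linked)
open import Data.Product using (_×_)
open import Relation.Binary.PropositionalEquality using (_≡_)
open import Relation.Nullary.Decidable using (_×-dec_)

fib : ℕ → ℕ
fib zero = 1
fib (suc zero) = 1
fib (suc (suc i)) = fib (suc i) + fib i

fibSum : List ℕ → ℕ
fibSum is = sum (map fib is)

-- A Fibonacci partition of n, represented by its (strictly increasing)
-- list of indices i_1 < … < i_h, all ≥ 1, with f_{i_1}+…+f_{i_h} = n.
-- (The set {f_{i_1},…,f_{i_h}} corresponds bijectively to this list.)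
IsFibPartition : ℕ → List ℕ → Set
IsFibPartition n is = AllPairs _<_ is × All (1 ≤_) is × fibSum is ≡ n

IsZeckendorf : ℕ → List ℕ → Set
IsZeckendorf n μs = IsFibPartition n μs × Linked (λ a b → 2 + a ≤ b) μs

-- 0-based list access with default 0 (only used at valid positions).
nth : List ℕ → ℕ → ℕ
nth [] _ = 0
nth (x ∷ xs) zero = x
nth (x ∷ xs) (suc k) = nth xs k

sublists : List ℕ → List (List ℕ)
sublists [] = [] ∷ []
sublists (x ∷ xs) = map (x ∷_) (sublists xs) ++ sublists xs

range1 : ℕ → List ℕ
range1 zero = []
range1 (suc n) = range1 n ++ (suc n ∷ [])

-- Every index
-- occurring in a Fibonacci partition of n is ≤ n (since f_i ≥ i for i ≥ 1),
-- so the partitions are exactly the increasing sublists of [1..n] with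
-- Fibonacci sum n.
F : ℕ → ℕ → ℕ
F h n = length (filter (λ is → (fibSum is ≟ n) ×-dec (length is ≟ h)) (sublists (range1 n)))

-- Coefficient of t^h in φ_α(t) = t + t² + … + t^α.
phiCoeff : ℕ → ℕ → ℕ
phiCoeff α zero = 0
phiCoeff α (suc h) with suc h ≤? α
... | yes _ = 1
... | no _ = 0

-- The exceptional partition of f_r for parameter k:
-- indices r-2k, then r-2k+1, r-2k+3, …, r-3, r-1.
oddTail : ℕ → ℕ → List ℕ
oddTail r zero = []
oddTail r (suc k) = ((r ∸ 2 * suc k) + 1) ∷ oddTail r k

family : ℕ → ℕ → List ℕ
family r k = (r ∸ 2 * k) ∷ oddTail r k

-- A partition with largest index a has sum below f_{a+2}, while a Zeckendorf sum with largest
-- index μ lies in [f_μ, f_{μ+1}); comparing the two brackets for the same n gives a ∈ {μ, μ-1},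
-- which is (a).  Applied repeatedly from the top, this shows that a partition of N + f_{c+1} with
-- N < f_c ends in a block summing to f_{c+1}, of one of the shapes listed in (b).  With N = 0 this
-- is (b), and peeling the Zeckendorf parts off from the largest one gives (c).  The count in (b)
-- holds because the listed partitions of f_r have the distinct lengths 1, …, ⌊(r-1)/2⌋+1.
module Submission where

open import Defs
open import Data.Nat using (ℕ; zero; suc; _+_; _∸_; _≤_; _<_; _/_; z≤n; s≤s; _≤?_; _≟_; _<?_; _≤′_; ≤′-reflexive; ≤′-step)
open import Data.Nat.Properties
open import Data.Nat.DivMod using (m/n≡1+[m∸n]/n)
open import Data.Nat.ListAction using (sum)
open import Data.Nat.ListAction.Properties using (sum-++)
open import Data.List using (List; []; _∷_; length; take; drop; _++_; map; _∷ʳ_; initLast; _∷ʳ′_)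
open import Data.List.Properties using (map-++; ++-assoc; ++-identityʳ; length-++; length-++-≤ˡ; length-drop; take++drop≡id; filter-none; filter-some; ∷-injectiveʳ)
open import Data.List.Membership.Propositional using (_∈_)
open import Data.List.Membership.Propositional.Properties using (∈-++⁺ʳ; ∈-++⁺ˡ; ∈-++⁻; ∈-map⁺; ∈-map⁻; ∈-filter⁻)
open import Data.List.Relation.Unary.Any using (here; there)
import Data.List.Relation.Unary.Any as Any
open import Data.List.Relation.Unary.All using (All; []; _∷_)
import Data.List.Relation.Unary.All as All
import Data.List.Relation.Unary.All.Properties as All
open import Data.List.Relation.Unary.AllPairs using (AllPairs; []; _∷_)
import Data.List.Relation.Unary.AllPairs as AllPairs
import Data.List.Relation.Unary.AllPairs.Properties as AllPairs
open import Data.List.Relation.Unary.Linked.Properties using (Linked⇒AllPairs)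
open import Data.List.Relation.Unary.Unique.Propositional using (Unique)
import Data.List.Relation.Unary.Unique.Propositional.Properties as Unique
open import Data.List.Relation.Binary.Disjoint.Propositional using (Disjoint)
open import Data.Product using (_×_; Σ; ∃₂; ∃-syntax; _,_; proj₁; proj₂)
open import Data.Sum using (_⊎_; inj₁; inj₂)
import Data.Sum as Sum
open import Relation.Nullary using (yes; no; contradiction)
open import Relation.Nullary.Decidable using (_×-dec_)
open import Relation.Binary.PropositionalEquality using (_≡_; _≢_; refl; sym; trans; cong; cong₂; subst)
open import Function.Bundles using (_⇔_; mk⇔)
open import Function.Properties.Equivalence using () renaming (trans to ⇔-trans)

fib-pos : ∀ n → 1 ≤ fib n
fib-pos zero = s≤s z≤n
fib-pos (suc zero) = s≤s z≤n
fib-pos (suc (suc n)) = ≤-trans (fib-pos (suc n)) (m≤m+n _ _)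

fib≢0 : ∀ n → fib n ≢ 0
fib≢0 n eq = <⇒≢ (fib-pos n) (sym eq)

fib≤fib-suc : ∀ n → fib n ≤ fib (suc n)
fib≤fib-suc zero = ≤-refl
fib≤fib-suc (suc n) = m≤m+n (fib (suc n)) (fib n)

fib-mono-≤ : ∀ {m n} → m ≤ n → fib m ≤ fib n
fib-mono-≤ m≤n = mono (≤⇒≤′ m≤n)
  where
  mono : ∀ {m n} → m ≤′ n → fib m ≤ fib n
  mono (≤′-reflexive refl) = ≤-refl
  mono (≤′-step {n} m≤′n) = ≤-trans (mono m≤′n) (fib≤fib-suc n)

fib-cancel-< : ∀ {m n} → fib m < fib n → m < n
fib-cancel-< fm<fn = ≰⇒> (λ n≤m → <⇒≱ fm<fn (fib-mono-≤ n≤m))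

n≤fib : ∀ n → n ≤ fib n
n≤fib zero = z≤n
n≤fib (suc zero) = ≤-refl
n≤fib (suc (suc n)) = subst (2 + n ≤_) (+-comm (fib n) _) (+-mono-≤ (fib-pos n) (n≤fib (suc n)))

fibSum-++ : ∀ xs ys → fibSum (xs ++ ys) ≡ fibSum xs + fibSum ys
fibSum-++ xs ys = trans (cong sum (map-++ fib xs ys)) (sum-++ (map fib xs) (map fib ys))

fibSum-∷ʳ : ∀ xs x → fibSum (xs ∷ʳ x) ≡ fibSum xs + fib x
fibSum-∷ʳ xs x = trans (fibSum-++ xs (x ∷ [])) (cong (fibSum xs +_) (+-identityʳ (fib x)))

fib≤fibSum : ∀ {x xs} → x ∈ xs → fib x ≤ fibSum xs
fib≤fibSum {xs = y ∷ ys} (here refl) = m≤m+n _ _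
fib≤fibSum {xs = y ∷ ys} (there x∈) = ≤-trans (fib≤fibSum x∈) (m≤n+m _ _)

fibSum≡0⇒[] : ∀ xs → fibSum xs ≡ 0 → xs ≡ []
fibSum≡0⇒[] [] _ = refl
fibSum≡0⇒[] (x ∷ xs) eq = contradiction (m+n≡0⇒m≡0 (fib x) eq) (fib≢0 x)

nonempty-by-fibSum : ∀ xs {N x} → fibSum xs ≡ N + fib x → 1 ≤ length xs
nonempty-by-fibSum [] {N} {x} eq = contradiction (m+n≡0⇒n≡0 N (sym eq)) (fib≢0 x)
nonempty-by-fibSum (_ ∷ _) _ = s≤s z≤n

fibSum-++-cancelʳ : ∀ L {H N X} → fibSum (L ++ H) ≡ N + X → fibSum H ≡ X → fibSum L ≡ N
fibSum-++-cancelʳ L {H} eq refl = +-cancelʳ-≡ (fibSum H) _ _ (trans (sym (fibSum-++ L H)) eq)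

fibSum-++-cancelˡ : ∀ L {H N X} → fibSum (L ++ H) ≡ N + X → fibSum L ≡ N → fibSum H ≡ X
fibSum-++-cancelˡ L {H} eq refl = +-cancelˡ-≡ (fibSum L) _ _ (trans (sym (fibSum-++ L H)) eq)

AllPairs-++⁻ : ∀ {A : Set} {R : A → A → Set} xs {ys} → AllPairs R (xs ++ ys) →
               AllPairs R xs × AllPairs R ys × All (λ x → All (R x) ys) xs
AllPairs-++⁻ [] rs = [] , rs , []
AllPairs-++⁻ (x ∷ xs) (rx ∷ rs) with AllPairs-++⁻ xs rs | All.++⁻ xs rx
... | rxs , rys , rxsys | rxxs , rxys = rxxs ∷ rxs , rys , rxys ∷ rxsys

AllPairs-∷ʳ⁻ : ∀ {A : Set} {R : A → A → Set} xs {x} → AllPairs R (xs ∷ʳ x) →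
               AllPairs R xs × All (λ y → R y x) xs
AllPairs-∷ʳ⁻ xs rs with AllPairs-++⁻ xs rs
... | rxs , _ , rxsx = rxs , All.map All.head rxsx

∷ʳ-maximum : ∀ xs {a} → AllPairs _<_ (xs ∷ʳ a) → All (_≤ a) (xs ∷ʳ a)
∷ʳ-maximum xs inc = All.∷ʳ⁺ (All.map <⇒≤ (proj₂ (AllPairs-∷ʳ⁻ xs inc))) ≤-refl

IsFibPartition-++⁻ˡ : ∀ L {H n} → IsFibPartition n (L ++ H) → IsFibPartition (fibSum L) L
IsFibPartition-++⁻ˡ L (inc , pos , _) = proj₁ (AllPairs-++⁻ L inc) , All.++⁻ˡ L pos , refl

IsFibPartition-∷ʳ⁺ : ∀ {s R a} → IsFibPartition s R → All (_< a) R → 1 ≤ a → IsFibPartition (s + fib a) (R ∷ʳ a)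
IsFibPartition-∷ʳ⁺ {R = R} {a} (inc , pos , refl) R<a 1≤a =
  AllPairs.++⁺ inc ([] ∷ []) (All.map (_∷ []) R<a) , All.∷ʳ⁺ pos 1≤a , fibSum-∷ʳ R a

IsFibPartition-∷ʳ⁻ : ∀ {s R a} → IsFibPartition (s + fib a) (R ∷ʳ a) → IsFibPartition s R
IsFibPartition-∷ʳ⁻ {R = R} {a} (inc , pos , eq) =
  proj₁ (AllPairs-∷ʳ⁻ R inc) , All.++⁻ˡ R pos , +-cancelʳ-≡ (fib a) _ _ (trans (sym (fibSum-∷ʳ R a)) eq)

Gap : ℕ → ℕ → Set
Gap a b = 2 + a ≤ b

IsSparse : List ℕ → Set
IsSparse μs = AllPairs Gap μs × All (1 ≤_) μs

IsZeckendorf⇒IsSparse : ∀ {n μs} → IsZeckendorf n μs → IsSparse μs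
IsZeckendorf⇒IsSparse ((_ , pos , _) , gaps) = Linked⇒AllPairs gap-trans gaps , pos
  where
  gap-trans : ∀ {a b c} → Gap a b → Gap b c → Gap a c
  gap-trans a+2≤b b+2≤c = ≤-trans a+2≤b (≤-trans (m≤n+m _ 2) b+2≤c)

IsSparse-++⁻ˡ : ∀ xs {ys} → IsSparse (xs ++ ys) → IsSparse xs
IsSparse-++⁻ˡ xs (gaps , pos) = proj₁ (AllPairs-++⁻ xs gaps) , All.++⁻ˡ xs pos

IsSparse⇒increasing : ∀ {μs} → IsSparse μs → AllPairs _<_ μs
IsSparse⇒increasing (gaps , _) = AllPairs.map (≤-trans (n≤1+n _)) gaps

fibSum-sparse-< : ∀ {t ys} → IsSparse ys → All (_< t) ys → fibSum ys < fib t
fibSum-sparse-< {t} (gaps , pos) ys<t = bound gaps pos ys<t z≤n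
  where
  open ≤-Reasoning
  bound : ∀ {l ys} → AllPairs Gap ys → All (l <_) ys → All (_< t) ys → l ≤ t → fib l + fibSum ys ≤ fib t
  bound [] [] [] l≤t = ≤-trans (≤-reflexive (+-identityʳ _)) (fib-mono-≤ l≤t)
  bound {l} {suc y ∷ ys} (gap ∷ gaps) (s≤s l≤y ∷ _) (y<t ∷ ys<t) _ = begin
    fib l + (fib (suc y) + fibSum ys)  ≤⟨ +-monoˡ-≤ _ (fib-mono-≤ l≤y) ⟩
    fib y + (fib (suc y) + fibSum ys)  ≡⟨ sym (+-assoc (fib y) _ _) ⟩
    (fib y + fib (suc y)) + fibSum ys  ≡⟨ cong (_+ fibSum ys) (+-comm (fib y) _) ⟩
    fib (2 + y) + fibSum ys            ≤⟨ bound gaps gap ys<t y<t ⟩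
    fib t                              ∎

fibSum-increasing-< : ∀ {a ys} → AllPairs _<_ ys → All (1 ≤_) ys → All (_≤ a) ys → fibSum ys < fib (2 + a)
fibSum-increasing-< {a} inc pos ys≤a = ≤-trans (n≤1+n _) (bound inc pos ys≤a z≤n)
  where
  open ≤-Reasoning
  bound : ∀ {l ys} → AllPairs _<_ ys → All (l <_) ys → All (_≤ a) ys → l ≤ a → fib (2 + l) + fibSum ys ≤ fib (2 + a)
  bound [] [] [] l≤a = ≤-trans (≤-reflexive (+-identityʳ _)) (fib-mono-≤ (s≤s (s≤s l≤a)))
  bound {l} {y ∷ ys} (y<ys ∷ inc) (l<y ∷ _) (y≤a ∷ ys≤a) _ = begin
    fib (2 + l) + (fib y + fibSum ys)  ≤⟨ +-monoˡ-≤ _ (fib-mono-≤ (s≤s l<y)) ⟩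
    fib (suc y) + (fib y + fibSum ys)  ≡⟨ sym (+-assoc (fib (suc y)) _ _) ⟩
    fib (2 + y) + fibSum ys            ≤⟨ bound inc y<ys ys≤a y≤a ⟩
    fib (2 + a)                        ∎

partition-bracket : ∀ {s as a} → IsFibPartition s as → a ∈ as → All (_≤ a) as → fib a ≤ s × s < fib (2 + a)
partition-bracket (inc , pos , refl) a∈ as≤a = fib≤fibSum a∈ , fibSum-increasing-< inc pos as≤a

partition-bracket-∷ʳ : ∀ {s R a} → IsFibPartition s (R ∷ʳ a) → fib a ≤ s × s < fib (2 + a)
partition-bracket-∷ʳ {R = R} p = partition-bracket p (∈-++⁺ʳ R (here refl)) (∷ʳ-maximum R (proj₁ p))

sparse-bracket : ∀ {μs μ} → IsSparse μs → μ ∈ μs → All (_≤ μ) μs → fib μ ≤ fibSum μs × fibSum μs < fib (suc μ)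
sparse-bracket sp μ∈ μs≤μ = fib≤fibSum μ∈ , fibSum-sparse-< sp (All.map s≤s μs≤μ)

top-index-squeeze : ∀ {a μ s} → fib a ≤ s → s < fib (2 + a) → fib μ ≤ s → s < fib (suc μ) → a ≡ μ ⊎ suc a ≡ μ
top-index-squeeze fa≤s s<fa+2 fμ≤s s<fμ+1 with m≤n⇒m<n∨m≡n (≤-pred (fib-cancel-< (≤-<-trans fa≤s s<fμ+1)))
... | inj₂ a≡μ = inj₁ a≡μ
... | inj₁ a<μ = inj₂ (≤-antisym a<μ (≤-pred (fib-cancel-< (≤-<-trans fμ≤s s<fa+2))))

largest-part-index : ∀ {n as μs a μ} → IsFibPartition n as → IsSparse μs → fibSum μs ≡ n →
                     a ∈ as → All (_≤ a) as → μ ∈ μs → All (_≤ μ) μs → a ≡ μ ⊎ suc a ≡ μ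
largest-part-index p sp refl a∈ as≤a μ∈ μs≤μ =
  let fa≤n , n<fa+2 = partition-bracket p a∈ as≤a
      fμ≤n , n<fμ+1 = sparse-bracket sp μ∈ μs≤μ
  in top-index-squeeze fa≤n n<fa+2 fμ≤n n<fμ+1

-- family r 0 is r ∷ [], so this covers both kinds of partition listed in (b).
InFamily : ℕ → List ℕ → Set
InFamily r as = ∃[ k ] k ≤ (r ∸ 1) / 2 × as ≡ family r k

oddTail-∷ʳ : ∀ d k → oddTail (2 + d) (suc k) ≡ oddTail d k ∷ʳ suc d
oddTail-∷ʳ d zero = cong (_∷ []) (+-comm d 1)
oddTail-∷ʳ d (suc k) = cong₂ _∷_ (cong (λ i → suc (suc d) ∸ i + 1) (*-suc 2 (suc k))) (oddTail-∷ʳ d k)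

family-∷ʳ : ∀ d k → family d k ∷ʳ suc d ≡ family (2 + d) (suc k)
family-∷ʳ d k = sym (cong₂ _∷_ (cong (suc (suc d) ∸_) (*-suc 2 k)) (oddTail-∷ʳ d k))

length-family : ∀ r k → length (family r k) ≡ suc k
length-family r k = cong suc (length-oddTail k)
  where
  length-oddTail : ∀ k → length (oddTail r k) ≡ k
  length-oddTail zero = refl
  length-oddTail (suc k) = cong suc (length-oddTail k)

half-2+ : ∀ n → (2 + n) / 2 ≡ suc (n / 2)
half-2+ n = m/n≡1+[m∸n]/n {2 + n} {2} (s≤s (s≤s z≤n))

InFamily-∷ʳ : ∀ r {H} → InFamily (suc r) H → InFamily (3 + r) (H ∷ʳ (2 + r))
InFamily-∷ʳ r (k , k≤ , refl) = suc k , subst (suc k ≤_) (sym (half-2+ r)) (s≤s k≤) , family-∷ʳ (suc r) k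

family-isFibPartition : ∀ r k → k ≤ r / 2 →
                        IsFibPartition (fib (suc r)) (family (suc r) k) × All (_≤ suc r) (family (suc r) k)
family-isFibPartition r zero _ = ([] ∷ [] , s≤s z≤n ∷ [] , +-identityʳ _) , ≤-refl ∷ []
family-isFibPartition (suc (suc r)) (suc k) k< with family-isFibPartition r k (≤-pred (subst (suc k ≤_) (half-2+ r) k<))
... | p , H≤ = subst (λ H → IsFibPartition (fib (3 + r)) H × All (_≤ 3 + r) H) (family-∷ʳ (suc r) k)
  ( subst (λ s → IsFibPartition s (family (suc r) k ∷ʳ (2 + r))) (+-comm (fib (suc r)) _)
      (IsFibPartition-∷ʳ⁺ p (All.map s≤s H≤) (s≤s z≤n))
  , All.∷ʳ⁺ (All.map (λ h≤ → ≤-trans h≤ (≤-trans (n≤1+n _) (n≤1+n _))) H≤) (n≤1+n _))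

InFamily⇒IsFibPartition : ∀ r {H} → InFamily (suc r) H → IsFibPartition (fib (suc r)) H
InFamily⇒IsFibPartition r (k , k≤ , refl) = proj₁ (family-isFibPartition r k k≤)

+-fib-unfold : ∀ N e → N + fib (3 + e) ≡ (N + fib (suc e)) + fib (2 + e)
+-fib-unfold N e = trans (cong (N +_) (+-comm (fib (2 + e)) _)) (sym (+-assoc N _ _))

last-part-index : ∀ c {N R a} → IsFibPartition (N + fib (suc c)) (R ∷ʳ a) → N < fib c → a ≡ suc c ⊎ a ≡ c
last-part-index c {N} p N<fc =
  let fa≤s , s<fa+2 = partition-bracket-∷ʳ p
  in Sum.map₂ suc-injective (top-index-squeeze fa≤s s<fa+2 (m≤n+m _ N)
       (<-≤-trans (+-monoˡ-< (fib (suc c)) N<fc) (≤-reflexive (+-comm (fib c) _))))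

largest-part-forced : ∀ {s R} e → IsFibPartition s R → All (_≤ suc e) R → fib (2 + e) ≤ s → ∃[ L ] R ≡ L ∷ʳ suc e
largest-part-forced {R = R} e p R≤ f≤s with initLast R
... | [] = contradiction (n≤0⇒n≡0 (subst (fib (2 + e) ≤_) (sym (proj₂ (proj₂ p))) f≤s)) (fib≢0 (2 + e))
... | L ∷ʳ′ t = L , cong (L ∷ʳ_) (≤-antisym (proj₂ (All.∷ʳ⁻ R≤)) e<t)
  where
  e<t : suc e ≤ t
  e<t = ≤-pred (≤-pred (fib-cancel-< (≤-<-trans f≤s (proj₂ (partition-bracket-∷ʳ p)))))

-- The largest part is f_{c+1} or f_c.  In the second case the other parts sum to N + f_{c-1}:
-- either N < f_{c-2} and we recurse, or these parts reach f_c and their largest is f_{c-1}.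
split-top : ∀ c {N} as → IsFibPartition (N + fib (suc c)) as → N < fib c →
            ∃₂ λ L H → as ≡ L ++ H × InFamily (suc c) H
split-below : ∀ c {N} R → IsFibPartition (N + fib (suc c)) (R ∷ʳ c) → N < fib c →
              ∃₂ λ L H → R ∷ʳ c ≡ L ++ H × InFamily (suc c) H

split-top c {N} as p N<fc with initLast as
... | [] = contradiction (m+n≡0⇒n≡0 N (sym (proj₂ (proj₂ p)))) (fib≢0 (suc c))
... | R ∷ʳ′ a with last-part-index c p N<fc
...   | inj₁ refl = R , a ∷ [] , refl , 0 , z≤n , refl
...   | inj₂ refl = split-below c R p N<fc

split-below zero R (_ , pos , _) _ with () ← proj₂ (All.∷ʳ⁻ pos)
split-below (suc zero) {N} R (inc , pos , eq) _ with R | inc | pos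
... | [] | _ | _ = contradiction (subst (2 ≤_) (sym eq) (m≤n+m 2 N)) λ { (s≤s ()) }
... | _ ∷ _ | x<rest ∷ _ | 1≤x ∷ _ = contradiction 1≤x (<⇒≱ (proj₂ (All.∷ʳ⁻ x<rest)))
split-below (suc (suc e)) {N} R p N<fc
  with N <? fib e | IsFibPartition-∷ʳ⁻ (subst (λ s → IsFibPartition s (R ∷ʳ (2 + e))) (+-fib-unfold N e) p)
... | yes N<fe | pR with split-top e R pR N<fe
...   | L , H , R≡ , fam = L , H ∷ʳ (2 + e) , trans (cong (_∷ʳ (2 + e)) R≡) (++-assoc L H _) , InFamily-∷ʳ e fam
split-below (suc (suc e)) {N} R p N<fc | no N≮fe | pR with largest-part-forced e pR R≤ f≤
  where
  R≤ : All (_≤ suc e) R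
  R≤ = All.map ≤-pred (proj₂ (AllPairs-∷ʳ⁻ R (proj₁ p)))
  f≤ : fib (2 + e) ≤ N + fib (suc e)
  f≤ = ≤-trans (+-monoʳ-≤ (fib (suc e)) (≮⇒≥ N≮fe)) (≤-reflexive (+-comm (fib (suc e)) N))
...   | L , refl = L , suc e ∷ 2 + e ∷ [] , ++-assoc L (suc e ∷ []) (2 + e ∷ []) , InFamily-∷ʳ e (0 , z≤n , refl)

fibPartition⇒InFamily : ∀ r {as} → IsFibPartition (fib (suc r)) as → InFamily (suc r) as
fibPartition⇒InFamily r p with split-top r _ p (fib-pos r)
... | L , H , refl , fam
  with refl ← fibSum≡0⇒[] L (fibSum-++-cancelʳ L (proj₂ (proj₂ p)) (proj₂ (proj₂ (InFamily⇒IsFibPartition r fam))))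
  = fam

fibPartition⇔InFamily : ∀ r as → IsFibPartition (fib (suc r)) as ⇔ InFamily (suc r) as
fibPartition⇔InFamily r as = mk⇔ (fibPartition⇒InFamily r) (InFamily⇒IsFibPartition r)

InFamily⇔listed : ∀ r as → InFamily r as ⇔ (as ≡ r ∷ [] ⊎ Σ ℕ (λ k → 1 ≤ k × k ≤ (r ∸ 1) / 2 × as ≡ family r k))
InFamily⇔listed r as = mk⇔ to from
  where
  to : InFamily r as → as ≡ r ∷ [] ⊎ Σ ℕ (λ k → 1 ≤ k × k ≤ (r ∸ 1) / 2 × as ≡ family r k)
  to (zero , _ , eq) = inj₁ eq
  to (suc k , k≤ , eq) = inj₂ (suc k , s≤s z≤n , k≤ , eq)
  from : as ≡ r ∷ [] ⊎ Σ ℕ (λ k → 1 ≤ k × k ≤ (r ∸ 1) / 2 × as ≡ family r k) → InFamily r as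
  from (inj₁ eq) = 0 , z≤n , eq
  from (inj₂ (k , _ , k≤ , eq)) = k , k≤ , eq

interval : ℕ → ℕ → List ℕ
interval a zero = []
interval a (suc k) = a ∷ interval (suc a) k

interval-∷ʳ : ∀ a k → interval a k ∷ʳ (a + k) ≡ interval a (suc k)
interval-∷ʳ a zero = cong (_∷ []) (+-identityʳ a)
interval-∷ʳ a (suc k) = cong (a ∷_) (trans (cong (interval (suc a) k ∷ʳ_) (+-suc a k)) (interval-∷ʳ (suc a) k))

range1≡interval : ∀ n → range1 n ≡ interval 1 n
range1≡interval zero = refl
range1≡interval (suc n) = trans (cong (_∷ʳ suc n) (range1≡interval n)) (interval-∷ʳ 1 n)

interval-≥ : ∀ a k → All (a ≤_) (interval a k)
interval-≥ a zero = []
interval-≥ a (suc k) = ≤-refl ∷ All.map (≤-trans (n≤1+n a)) (interval-≥ (suc a) k)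

interval-increasing : ∀ a k → AllPairs _<_ (interval a k)
interval-increasing a zero = []
interval-increasing a (suc k) = interval-≥ (suc a) k ∷ interval-increasing (suc a) k

sublists-All : ∀ {P : ℕ → Set} xs {ys} → ys ∈ sublists xs → All P xs → All P ys
sublists-All [] (here refl) [] = []
sublists-All (x ∷ xs) ys∈ (px ∷ pxs) with ∈-++⁻ (map (x ∷_) (sublists xs)) ys∈
... | inj₂ ys∈′ = sublists-All xs ys∈′ pxs
... | inj₁ ys∈map with ∈-map⁻ (x ∷_) ys∈map
...   | zs , zs∈ , refl = px ∷ sublists-All xs zs∈ pxs

sublists-AllPairs : ∀ {R : ℕ → ℕ → Set} xs {ys} → ys ∈ sublists xs → AllPairs R xs → AllPairs R ys
sublists-AllPairs [] (here refl) [] = []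
sublists-AllPairs (x ∷ xs) ys∈ (rx ∷ rxs) with ∈-++⁻ (map (x ∷_) (sublists xs)) ys∈
... | inj₂ ys∈′ = sublists-AllPairs xs ys∈′ rxs
... | inj₁ ys∈map with ∈-map⁻ (x ∷_) ys∈map
...   | zs , zs∈ , refl = sublists-All xs zs∈ rx ∷ sublists-AllPairs xs zs∈ rxs

sublists-Unique : ∀ xs → Unique xs → Unique (sublists xs)
sublists-Unique [] [] = [] ∷ []
sublists-Unique (x ∷ xs) (x∉xs ∷ u) = Unique.++⁺ (Unique.map⁺ ∷-injectiveʳ ih) ih disjoint
  where
  ih = sublists-Unique xs u
  disjoint : Disjoint (map (x ∷_) (sublists xs)) (sublists xs)
  disjoint (v∈map , v∈) with ∈-map⁻ (x ∷_) v∈map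
  ... | _ , _ , refl = All.head (sublists-All xs v∈ x∉xs) refl

∈-sublists-interval : ∀ a k {ys} → AllPairs _<_ ys → All (a ≤_) ys → All (_< a + k) ys → ys ∈ sublists (interval a k)
∈-sublists-interval a zero {[]} _ _ _ = here refl
∈-sublists-interval a zero {y ∷ _} _ (a≤y ∷ _) (y<a+0 ∷ _) = contradiction a≤y (<⇒≱ (subst (y <_) (+-identityʳ a) y<a+0))
∈-sublists-interval a (suc k) {[]} _ _ _ = ∈-++⁺ʳ _ (∈-sublists-interval (suc a) k [] [] [])
∈-sublists-interval a (suc k) {y ∷ ys} (y<ys ∷ inc) (a≤y ∷ _) ys<a+k+1 with a ≟ y
... | yes refl = ∈-++⁺ˡ (∈-map⁺ (a ∷_) (∈-sublists-interval (suc a) k inc y<ys (All.tail shifted)))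
  where shifted = All.map (λ {z} z< → subst (z <_) (+-suc a k) z<) ys<a+k+1
... | no a≢y = ∈-++⁺ʳ _ (∈-sublists-interval (suc a) k (y<ys ∷ inc) (a<y ∷ All.map (<-trans a<y) y<ys) shifted)
  where
  a<y = ≤∧≢⇒< a≤y a≢y
  shifted = All.map (λ {z} z< → subst (z <_) (+-suc a k) z<) ys<a+k+1

candidate⇒increasing : ∀ n {ys} → ys ∈ sublists (range1 n) → AllPairs _<_ ys × All (1 ≤_) ys
candidate⇒increasing n ys∈ =
  sublists-AllPairs (interval 1 n) ys∈′ (interval-increasing 1 n) , sublists-All (interval 1 n) ys∈′ (interval-≥ 1 n)
  where ys∈′ = subst (λ xs → _ ∈ sublists xs) (range1≡interval n) ys∈

IsFibPartition⇒candidate : ∀ {n ys} → IsFibPartition n ys → ys ∈ sublists (range1 n)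
IsFibPartition⇒candidate {n} {ys} (inc , pos , refl) =
  subst (λ xs → ys ∈ sublists xs) (sym (range1≡interval n))
    (∈-sublists-interval 1 n inc pos (All.tabulate (λ {y} y∈ → s≤s (≤-trans (n≤fib y) (fib≤fibSum y∈)))))

candidates-Unique : ∀ n → Unique (sublists (range1 n))
candidates-Unique n = subst (λ xs → Unique (sublists xs)) (sym (range1≡interval n))
  (sublists-Unique (interval 1 n) (AllPairs.map <⇒≢ (interval-increasing 1 n)))

Unique∧constant⇒length≤1 : ∀ {A : Set} {x : A} {xs} → Unique xs → All (_≡ x) xs → length xs ≤ 1
Unique∧constant⇒length≤1 [] [] = z≤n
Unique∧constant⇒length≤1 (_ ∷ []) (_ ∷ []) = s≤s z≤n
Unique∧constant⇒length≤1 ((y≢z ∷ _) ∷ _) (refl ∷ refl ∷ _) = contradiction refl y≢z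

F≡0 : ∀ {h n} → (∀ {ys} → IsFibPartition n ys → length ys ≢ h) → F h n ≡ 0
F≡0 {h} {n} none = cong length (filter-none P? (All.tabulate (λ {ys} ys∈ (sum≡ , len≡) →
    let inc , pos = candidate⇒increasing n ys∈ in none (inc , pos , sum≡) len≡)))
  where P? = λ is → (fibSum is ≟ n) ×-dec (length is ≟ h)

F≡1 : ∀ {h n L} → IsFibPartition n L → length L ≡ h →
      (∀ {ys} → IsFibPartition n ys → length ys ≡ h → ys ≡ L) → F h n ≡ 1
F≡1 {h} {n} {L} pL lenL unique = ≤-antisym
  (Unique∧constant⇒length≤1 (Unique.filter⁺ P? (candidates-Unique n)) (All.tabulate (λ {ys} ys∈ →
    let ys∈S , sum≡ , len≡ = ∈-filter⁻ P? ys∈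
        inc , pos = candidate⇒increasing n ys∈S
    in unique (inc , pos , sum≡) len≡)))
  (filter-some P? (Any.map (λ { refl → proj₂ (proj₂ pL) , lenL }) (IsFibPartition⇒candidate pL)))
  where P? = λ is → (fibSum is ≟ n) ×-dec (length is ≟ h)

F-fib : ∀ r h → F h (fib (suc r)) ≡ phiCoeff (r / 2 + 1) h
F-fib r zero = F≡0 no-empty
  where
  no-empty : ∀ {ys} → IsFibPartition (fib (suc r)) ys → length ys ≢ 0
  no-empty p with fibPartition⇒InFamily r p
  ... | k , _ , refl = λ len → 1+n≢0 (trans (sym (length-family (suc r) k)) len)
F-fib r (suc h) with suc h ≤? r / 2 + 1
... | yes h<α = F≡1 (proj₁ (family-isFibPartition r h h≤)) (length-family (suc r) h) only-family
  where
  h≤ : h ≤ r / 2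
  h≤ = ≤-pred (≤-trans h<α (≤-reflexive (+-comm (r / 2) 1)))
  only-family : ∀ {ys} → IsFibPartition (fib (suc r)) ys → length ys ≡ suc h → ys ≡ family (suc r) h
  only-family p len with fibPartition⇒InFamily r p
  ... | k , _ , refl = cong (family (suc r)) (suc-injective (trans (sym (length-family (suc r) k)) len))
... | no h≮α = F≡0 too-long
  where
  too-long : ∀ {ys} → IsFibPartition (fib (suc r)) ys → length ys ≢ suc h
  too-long p len with fibPartition⇒InFamily r p
  ... | k , k≤ , refl = h≮α (subst (_≤ r / 2 + 1) (trans (sym (length-family (suc r) k)) len)
                               (≤-trans (s≤s k≤) (≤-reflexive (+-comm 1 (r / 2)))))

sparse-∷ʳ-bound : ∀ μs {x} → IsSparse (μs ∷ʳ x) → ∃[ c ] x ≡ suc c × fibSum μs < fib c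
sparse-∷ʳ-bound μs {zero} (_ , pos) with () ← proj₂ (All.∷ʳ⁻ pos)
sparse-∷ʳ-bound μs {suc c} (gaps , pos) =
  c , refl , fibSum-sparse-< (proj₁ (AllPairs-∷ʳ⁻ μs gaps) , All.++⁻ˡ μs pos) (All.map ≤-pred (proj₂ (AllPairs-∷ʳ⁻ μs gaps)))

split-prefix : ∀ μ₂ μ₁ {as} → IsSparse (μ₁ ++ μ₂) → IsFibPartition (fibSum (μ₁ ++ μ₂)) as →
               ∃₂ λ L H → as ≡ L ++ H × fibSum L ≡ fibSum μ₁
split-prefix [] μ₁ {as} _ (_ , _ , eq) = as , [] , sym (++-identityʳ as) , trans eq (cong fibSum (++-identityʳ μ₁))
split-prefix (x ∷ μ₂) μ₁ {as} sp p
  with split-prefix μ₂ (μ₁ ∷ʳ x) (subst IsSparse (sym assoc) sp) (subst (λ μs → IsFibPartition (fibSum μs) as) (sym assoc) p)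
  where assoc = ++-assoc μ₁ (x ∷ []) μ₂
... | L′ , H′ , refl , sumL′ with sparse-∷ʳ-bound μ₁ (IsSparse-++⁻ˡ (μ₁ ∷ʳ x) (subst IsSparse (sym (++-assoc μ₁ (x ∷ []) μ₂)) sp))
...   | c , refl , μ₁<fc
  with split-top c L′ (subst (λ s → IsFibPartition s L′) (trans sumL′ (fibSum-∷ʳ μ₁ (suc c))) (IsFibPartition-++⁻ˡ L′ p)) μ₁<fc
...     | L , H , refl , fam = L , H ++ H′ , ++-assoc L H H′ ,
          fibSum-++-cancelʳ L (trans sumL′ (fibSum-∷ʳ μ₁ (suc c))) (proj₂ (proj₂ (InFamily⇒IsFibPartition c fam)))

take-suc-nth : ∀ m xs → m < length xs → take (suc m) xs ≡ take m xs ∷ʳ nth xs m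
take-suc-nth zero (x ∷ xs) _ = refl
take-suc-nth (suc m) (x ∷ xs) (s≤s m<) = cong (x ∷_) (take-suc-nth m xs m<)

take-length-++ : ∀ (L H : List ℕ) → take (length L) (L ++ H) ≡ L
take-length-++ [] H = refl
take-length-++ (x ∷ L) H = cong (x ∷_) (take-length-++ L H)

nth-length-++ : ∀ L H h → nth (L ++ h ∷ H) (length L) ≡ h
nth-length-++ [] H h = refl
nth-length-++ (x ∷ L) H h = nth-length-++ L H h

-- The largest parts of L and of μ₁ ∷ʳ x differ by at most one, and h exceeds the former.
boundary-part : ∀ L {h H μ₁ x} → AllPairs _<_ (L ++ h ∷ H) → All (1 ≤_) L → IsSparse (μ₁ ∷ʳ x) →
                fibSum L ≡ fibSum (μ₁ ∷ʳ x) → x ≤ h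
boundary-part L {μ₁ = μ₁} {x} inc pos sp sumL with initLast L
... | [] = contradiction (m+n≡0⇒n≡0 (fibSum μ₁) (trans (sym (fibSum-∷ʳ μ₁ x)) (sym sumL))) (fib≢0 x)
... | L₀ ∷ʳ′ t with AllPairs-++⁻ (L₀ ∷ʳ t) inc
...   | incL , _ , L<rest with largest-part-index (incL , pos , sumL) sp refl
                                 (∈-++⁺ʳ L₀ (here refl)) (∷ʳ-maximum L₀ incL)
                                 (∈-++⁺ʳ μ₁ (here refl)) (∷ʳ-maximum μ₁ (IsSparse⇒increasing sp))
...     | t≡x⊎t+1≡x = ≤-trans x≤1+t (All.head (proj₂ (All.∷ʳ⁻ L<rest)))
  where
  x≤1+t : x ≤ suc t
  x≤1+t = Sum.[ (λ { refl → n≤1+n t }) , (λ { refl → ≤-refl }) ] t≡x⊎t+1≡x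

next-part : ∀ L {H μ₁ x μ₂} → AllPairs _<_ (L ++ H) → All (1 ≤_) L → IsSparse (μ₁ ∷ʳ x) →
            fibSum L ≡ fibSum (μ₁ ∷ʳ x) → fibSum H ≡ fibSum μ₂ → 1 ≤ length μ₂ →
            length L < length (L ++ H) × x ≤ nth (L ++ H) (length L)
next-part L {[]} {μ₂ = μ₂} _ _ _ _ sumH len with refl ← fibSum≡0⇒[] μ₂ (sym sumH) with () ← len
next-part L {h ∷ H} inc pos sp sumL _ _ =
  subst (length L <_) (sym (length-++ L)) (m<m+n (length L) (s≤s z≤n)) ,
  subst (_ ≤_) (sym (nth-length-++ L H h)) (boundary-part L inc pos sp sumL)

rigidity : ∀ {n μs as} → IsSparse μs → fibSum μs ≡ n → IsFibPartition n as → ∀ m → m < length μs →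
           Σ ℕ (λ s → 1 ≤ s × s ≤ length as × fibSum (take s as) ≡ fibSum (take (suc m) μs) ×
             (suc m < length μs → s < length as × fib (nth μs m) ≤ fib (nth as s)))
rigidity {μs = μs} {as} sp refl p m m<
  with split-prefix (drop (suc m) μs) (take (suc m) μs) (subst IsSparse (sym split) sp)
         (subst (λ xs → IsFibPartition (fibSum xs) as) (sym split) p)
  where split = take++drop≡id (suc m) μs
... | L , H , refl , sumL =
  length L , nonempty-by-fibSum L {x = μ} (trans sumL′ (fibSum-∷ʳ μ₁ μ)) , length-++-≤ˡ L ,
  trans (cong fibSum (take-length-++ L H)) sumL , next
  where
  μ₁ = take m μs
  μ = nth μs m
  sumL′ : fibSum L ≡ fibSum (μ₁ ∷ʳ μ)
  sumL′ = trans sumL (cong fibSum (take-suc-nth m μs m<))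
  next : suc m < length μs → length L < length (L ++ H) × fib μ ≤ fib (nth (L ++ H) (length L))
  next m+1< =
    let inc , pos , sum≡ = p
        sp₁ = subst IsSparse (take-suc-nth m μs m<) (AllPairs.take⁺ (suc m) (proj₁ sp) , All.take⁺ (suc m) (proj₂ sp))
        sum-split = trans (cong fibSum (sym (take++drop≡id (suc m) μs))) (fibSum-++ (take (suc m) μs) _)
        sumH = fibSum-++-cancelˡ L {H} (trans sum≡ sum-split) sumL
        s< , μ≤ = next-part L {H} {μ₁} {μ} {drop (suc m) μs} inc (All.++⁻ˡ L pos) sp₁ sumL′ sumH
                    (subst (1 ≤_) (sym (length-drop (suc m) μs)) (m<n⇒0<n∸m m+1<))
    in s< , fib-mono-≤ μ≤

lemma1p5 :
    -- (a) the greatest part of a Fibonacci partition of n is f_{μ_q} or f_{μ_q - 1}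
    (∀ (n : ℕ) (μs as : List ℕ) → 1 ≤ n → IsZeckendorf n μs → IsFibPartition n as →
      ∀ (a μq : ℕ) → a ∈ as → All (_≤ a) as → μq ∈ μs → All (_≤ μq) μs →
      (fib a ≡ fib μq ⊎ fib a ≡ fib (μq ∸ 1)))
    ×
    -- (b) the Fibonacci partitions of f_r, and F(f_r; t) = φ_{⌊(r-1)/2⌋+1}(t)
    (∀ (r : ℕ) → 1 ≤ r →
      (∀ (as : List ℕ) → IsFibPartition (fib r) as ⇔
        (as ≡ r ∷ [] ⊎ Σ ℕ (λ k → 1 ≤ k × k ≤ (r ∸ 1) / 2 × as ≡ family r k)))
      × (∀ (h : ℕ) → F h (fib r) ≡ phiCoeff ((r ∸ 1) / 2 + 1) h))
    ×
    -- (c) rigidity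
    (∀ (n : ℕ) (μs as : List ℕ) → 1 ≤ n → IsZeckendorf n μs → IsFibPartition n as →
      ∀ (m : ℕ) → 1 ≤ m → m ≤ length μs →
      Σ ℕ (λ s → 1 ≤ s × s ≤ length as ×
        fibSum (take s as) ≡ fibSum (take m μs) ×
        (m < length μs → s < length as × fib (nth μs (m ∸ 1)) ≤ fib (nth as s))))
lemma1p5 =
  (λ n μs as _ z p a μq a∈ as≤a μq∈ μs≤μq →
    Sum.map (cong fib) (λ { refl → refl })
      (largest-part-index p (IsZeckendorf⇒IsSparse z) (proj₂ (proj₂ (proj₁ z))) a∈ as≤a μq∈ μs≤μq)) ,
  (λ { zero ()
     ; (suc r) _ → (λ as → ⇔-trans (fibPartition⇔InFamily r as) (InFamily⇔listed (suc r) as)) , F-fib r }) ,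
  (λ n μs as _ z p → λ
    { zero () _
    ; (suc m) _ m< → rigidity (IsZeckendorf⇒IsSparse z) (proj₂ (proj₂ (proj₁ z))) p m m< })
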